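{- If $D$ is a star-generating digraph with $k$ sources for some positive integer $k$, then for every positive integer $m$ the $m$-step competition graph $C^m(D)$ is a disjoint union of $k$ nontrivial star graphs, the center of each of which is a source in $D$.
   Context: All digraphs are finite, may have loops, and (standing assumption) every vertex has outdegree at least $1$. For a positive integer $m$, a vertex $y$ is an $m$-step prey of $x$ (and $x$ an $m$-step predator of $y$) if there is a directed walk of length $m$ from $x$ to $y$; $1$-step prey/predators are called prey/predators. The $m$-step competition graph $C^m(D)$ has vertex set $V(D)$ and an edge between distinct vertices $x,y$ iff they have a common $m$-step prey. A source is a vertex of indegree $0$. $D$ is weakly connected if its underlying undirected graph is connected. A weakly connected digraph $D$ is star-generating if: ($S_1$) $D$ has at least one source and, for each source $v$, each prey of $v$ has exactly two predators; ($S_2$) no two sources of $D$ have a common prey; ($S_3$) each non-source vertex has exactly one prey and exactly two predators, one of which is a source and the other of which is a non-source vertex. A star graph is $K_{1,r}$ ($r\ge0$) with center the vertex of degree $r$; it is nontrivial if it has at least two vertices. -}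

module Defs where

open import Data.Nat using (ℕ; zero; suc)
open import Data.Fin using (Fin)
open import Data.Bool using (Bool; T)
open import Data.Product using (Σ; ∃; ∃-syntax; _×_; _,_)
open import Data.Sum using (_⊎_)
open import Relation.Nullary using (¬_)
open import Relation.Binary.PropositionalEquality using (_≡_; _≢_)
open import Relation.Binary.Construct.Closure.ReflexiveTransitive using (Star)
open import Function.Bundles using (_⇔_)

record Digraph : Set where
  field
    n : ℕ
    E : Fin n → Fin n → Bool

open Digraph public

module _ (D : Digraph) where

  Vertex : Set
  Vertex = Fin (n D)

  -- arc x → y  (y is a prey of x, x is a predator of y)
  Arc : Vertex → Vertex → Set
  Arc x y = T (E D x y)

  OutdegPos : Set
  OutdegPos = ∀ x → ∃[ y ] Arc x y

  Walk : ℕ → Vertex → Vertex → Set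
  Walk zero    x y = x ≡ y
  Walk (suc m) x y = ∃[ z ] (Arc x z × Walk m z y)

  MPrey : ℕ → Vertex → Vertex → Set
  MPrey m x y = Walk m x y

  CompEdge : ℕ → Vertex → Vertex → Set
  CompEdge m x y = x ≢ y × ∃[ z ] (MPrey m x z × MPrey m y z)

  Source : Vertex → Set
  Source v = ∀ u → ¬ Arc u v

  UArc : Vertex → Vertex → Set
  UArc x y = Arc x y ⊎ Arc y x

  WeaklyConnected : Set
  WeaklyConnected = ∀ x y → Star UArc x y

  ExactlyTwoPredators : Vertex → Set
  ExactlyTwoPredators v =
    ∃[ a ] ∃[ b ] (a ≢ b × (∀ u → Arc u v ⇔ (u ≡ a ⊎ u ≡ b)))

  ExactlyOnePrey : Vertex → Set
  ExactlyOnePrey v = ∃[ a ] (∀ u → Arc v u ⇔ (u ≡ a))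

  HasKSources : ℕ → Set
  HasKSources k =
    Σ (Fin k → Vertex) λ s →
      (∀ i j → s i ≡ s j → i ≡ j) × (∀ v → Source v ⇔ (∃[ i ] s i ≡ v))

  StarGenerating : Set
  StarGenerating =
    WeaklyConnected
    -- (S1)
    × (∃[ v ] Source v)
    × (∀ v y → Source v → Arc v y → ExactlyTwoPredators y)
    × (∀ v w y → Source v → Source w → v ≢ w → ¬ (Arc v y × Arc w y))
    × (∀ v → ¬ Source v →
         ExactlyOnePrey v
         × ∃[ a ] ∃[ b ] (a ≢ b × Source a × ¬ Source b
                           × (∀ u → Arc u v ⇔ (u ≡ a ⊎ u ≡ b))))

-- A graph on Fin N (given by its edge relation) is a disjoint union of
-- k nontrivial star graphs whose centers satisfy P:
-- there are centers ctr : Fin k → Fin N and a component assignment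
-- comp : Fin N → Fin k such that each center lies in its own component,
-- each component has a vertex other than its center, and the edges are
-- exactly the pairs {center, other vertex} inside a component.
DisjointUnionOfStars : {N : ℕ} → (Fin N → Fin N → Set) → ℕ → (Fin N → Set) → Set
DisjointUnionOfStars {N} Edge k P =
  Σ (Fin k → Fin N) λ ctr → Σ (Fin N → Fin k) λ comp →
      (∀ i → comp (ctr i) ≡ i)
    × (∀ i → P (ctr i))
    × (∀ i → ∃[ v ] (comp v ≡ i × v ≢ ctr i))
    × (∀ x y → Edge x y ⇔
         (comp x ≡ comp y × x ≢ y × (x ≡ ctr (comp x) ⊎ y ≡ ctr (comp y))))

module Submission where

open import Defs
open import Data.Nat using (ℕ; _≤_; zero; suc)
open import Data.Fin using (Fin)
open import Data.Fin.Properties using (any?; _≟_)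
open import Data.Product using (∃; ∃-syntax; _×_; _,_; proj₁; proj₂)
open import Data.Sum using (_⊎_; inj₁; inj₂)
open import Data.Empty using (⊥-elim)
open import Relation.Nullary using (¬_; Dec; yes; no)
open import Relation.Nullary.Decidable using (map)
open import Relation.Binary.PropositionalEquality
  using (_≡_; _≢_; refl; sym; trans; subst; cong; ≢-sym)
open import Function.Bundles using (_⇔_; mk⇔; Equivalence)
open Equivalence using (to; from)
import Function.Properties.Equivalence as ⇔

-- For m ≥ 1 two vertices of a star-generating digraph compete in C^m(D)
-- iff they already have a common prey: the first steps of two m-walks to
-- the same vertex are non-sources, and a non-source has at most one
-- non-source predator, so the walks agree from the first step on.  Two
-- vertices with a common prey are a source s and a non-source sharing a
-- prey with s, and every non-source shares a prey with exactly one source,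
-- which partitions the vertices into stars centred at the sources.

module WalkProperties (D : Digraph) where

  CommonPrey : Vertex D → Vertex D → Set
  CommonPrey x y = ∃[ w ] (Arc D x w × Arc D y w)

  NonSourcePredatorUnique : Set
  NonSourcePredatorUnique =
    ∀ {u u' y} → ¬ Source D u → ¬ Source D u' → Arc D u y → Arc D u' y → u ≡ u'

  prey-nonSource : ∀ {u y} → Arc D u y → ¬ Source D y
  prey-nonSource {u} u→y y-src = y-src u u→y

  walk-exists : OutdegPos D → ∀ m x → ∃[ z ] Walk D m x z
  walk-exists od zero    x = x , refl
  walk-exists od (suc m) x =
    let (y , x→y) = od x ; (z , y⇝z) = walk-exists od m y in z , y , x→y , y⇝z

  walk-start-unique : NonSourcePredatorUnique → ∀ m {x x' z} →
    ¬ Source D x → ¬ Source D x' → Walk D m x z → Walk D m x' z → x ≡ x'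
  walk-start-unique uniq zero    _ _ x≡z x'≡z = trans x≡z (sym x'≡z)
  walk-start-unique uniq (suc m) nx nx' (w , x→w , w⇝z) (w' , x'→w' , w'⇝z) =
    uniq nx nx' x→w (subst (Arc D _) (sym w≡w') x'→w')
    where
    w≡w' : w ≡ w'
    w≡w' = walk-start-unique uniq m
             (prey-nonSource x→w) (prey-nonSource x'→w') w⇝z w'⇝z

  compEdge⇔commonPrey : OutdegPos D → NonSourcePredatorUnique → ∀ m x y →
    CompEdge D (suc m) x y ⇔ (x ≢ y × CommonPrey x y)
  compEdge⇔commonPrey od uniq m x y = mk⇔ shorten extend
    where
    shorten : CompEdge D (suc m) x y → x ≢ y × CommonPrey x y
    shorten (x≢y , z , (w , x→w , w⇝z) , (w' , y→w' , w'⇝z)) =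
      x≢y , w , x→w , subst (Arc D y) w'≡w y→w'
      where
      w'≡w = walk-start-unique uniq m
               (prey-nonSource y→w') (prey-nonSource x→w) w'⇝z w⇝z

    extend : x ≢ y × CommonPrey x y → CompEdge D (suc m) x y
    extend (x≢y , w , x→w , y→w) =
      let (z , w⇝z) = walk-exists od m w in
      x≢y , z , (w , x→w , w⇝z) , (w , y→w , w⇝z)

module StarDecomposition (D : Digraph) (od : OutdegPos D) (sg : StarGenerating D)
                         {k : ℕ} (hk : HasKSources D k) where

  open WalkProperties D

  center : Fin k → Vertex D
  center = proj₁ hk

  center-injective : ∀ i j → center i ≡ center j → i ≡ j
  center-injective = proj₁ (proj₂ hk)

  source⇔center : ∀ v → Source D v ⇔ (∃[ i ] center i ≡ v)
  source⇔center = proj₂ (proj₂ hk)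

  center-source : ∀ i → Source D (center i)
  center-source i = from (source⇔center (center i)) (i , refl)

  source? : ∀ v → Dec (Source D v)
  source? v = map (⇔.sym (source⇔center v))
                  (any? (λ i → center i ≟ v))

  private
    S2 : ∀ v w y → Source D v → Source D w → v ≢ w → ¬ (Arc D v y × Arc D w y)
    S2 = let (_ , _ , _ , s2 , _) = sg in s2

    S3 : ∀ v → ¬ Source D v →
      ExactlyOnePrey D v
      × ∃[ a ] ∃[ b ] (a ≢ b × Source D a × ¬ Source D b
                        × (∀ u → Arc D u v ⇔ (u ≡ a ⊎ u ≡ b)))
    S3 = let (_ , _ , _ , _ , s3) = sg in s3

  sourcePredator-unique : ∀ {s s' y} → Source D s → Source D s' →
    Arc D s y → Arc D s' y → s ≡ s'
  sourcePredator-unique {s} {s'} {y} s-src s'-src s→y s'→y with s ≟ s'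
  ... | yes s≡s' = s≡s'
  ... | no  s≢s' = ⊥-elim (S2 s s' y s-src s'-src s≢s' (s→y , s'→y))

  prey-unique : ∀ {v y y'} → ¬ Source D v → Arc D v y → Arc D v y' → y ≡ y'
  prey-unique {v} {y} {y'} nv v→y v→y' with S3 v nv
  ... | (_ , prey⇔p) , _ = trans (to (prey⇔p y) v→y) (sym (to (prey⇔p y') v→y'))

  prey-exists : ∀ {v} → ¬ Source D v → ∃[ y ] Arc D v y
  prey-exists {v} nv with S3 v nv
  ... | (p , prey⇔p) , _ = p , from (prey⇔p p) refl

  sourcePredator : ∀ {v} → ¬ Source D v → ∃[ s ] (Source D s × Arc D s v)
  sourcePredator {v} nv with S3 v nv
  ... | _ , (a , _ , _ , a-src , _ , pred⇔) = a , a-src , from (pred⇔ a) (inj₁ refl)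

  nonSourcePredator : ∀ {v} → ¬ Source D v → ∃[ u ] (¬ Source D u × Arc D u v)
  nonSourcePredator {v} nv with S3 v nv
  ... | _ , (_ , b , _ , _ , nb , pred⇔) = b , nb , from (pred⇔ b) (inj₂ refl)

  nonSourcePredator-unique : NonSourcePredatorUnique
  nonSourcePredator-unique {u} {u'} {y} nu nu' u→y u'→y with S3 y (prey-nonSource u→y)
  ... | _ , (a , b , _ , a-src , _ , pred⇔) = trans (≡b nu u→y) (sym (≡b nu' u'→y))
    where
    ≡b : ∀ {w} → ¬ Source D w → Arc D w y → w ≡ b
    ≡b {w} nw w→y with to (pred⇔ w) w→y
    ... | inj₁ w≡a = ⊥-elim (nw (subst (Source D) (sym w≡a) a-src))
    ... | inj₂ w≡b = w≡b

  commonPrey-source-nonSource : ∀ {x y} → x ≢ y → CommonPrey x y →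
    (Source D x × ¬ Source D y) ⊎ (¬ Source D x × Source D y)
  commonPrey-source-nonSource {x} {y} x≢y (w , x→w , y→w) with source? x | source? y
  ... | yes sx | yes sy = ⊥-elim (x≢y (sourcePredator-unique sx sy x→w y→w))
  ... | no  nx | no  ny = ⊥-elim (x≢y (nonSourcePredator-unique nx ny x→w y→w))
  ... | yes sx | no  ny = inj₁ (sx , ny)
  ... | no  nx | yes sy = inj₂ (nx , sy)

  Attached : Vertex D → Vertex D → Set
  Attached s x = x ≡ s ⊎ (¬ Source D x × CommonPrey s x)

  attached-unique : ∀ {i j x} → Attached (center i) x → Attached (center j) x → i ≡ j
  attached-unique {i} {j} p q = center-injective i j (go p q)
    where
    go : ∀ {x} → Attached (center i) x → Attached (center j) x → center i ≡ center j
    go (inj₁ x≡ci) (inj₁ x≡cj) = trans (sym x≡ci) x≡cj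
    go (inj₁ x≡ci) (inj₂ (nx , _)) = ⊥-elim (nx (subst (Source D) (sym x≡ci) (center-source i)))
    go (inj₂ (nx , _)) (inj₁ x≡cj) = ⊥-elim (nx (subst (Source D) (sym x≡cj) (center-source j)))
    go (inj₂ (nx , w , ci→w , x→w)) (inj₂ (_ , w' , cj→w' , x→w')) =
      sourcePredator-unique (center-source i) (center-source j)
        ci→w (subst (Arc D _) (prey-unique nx x→w' x→w) cj→w')

  attached-exists : ∀ x → ∃[ i ] Attached (center i) x
  attached-exists x with source? x
  ... | yes x-src = let (i , ci≡x) = to (source⇔center x) x-src in i , inj₁ (sym ci≡x)
  ... | no  nx =
    let (y , x→y) = prey-exists nx
        (s , s-src , s→y) = sourcePredator (prey-nonSource x→y)
        (i , ci≡s) = to (source⇔center s) s-src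
    in i , inj₂ (nx , y , subst (λ c → Arc D c y) (sym ci≡s) s→y , x→y)

  star : Vertex D → Fin k
  star x = proj₁ (attached-exists x)

  star-attached : ∀ x → Attached (center (star x)) x
  star-attached x = proj₂ (attached-exists x)

  star-unique : ∀ {i x} → Attached (center i) x → star x ≡ i
  star-unique = attached-unique (star-attached _)

  star-center : ∀ i → star (center i) ≡ i
  star-center i = star-unique (inj₁ refl)

  source-is-center : ∀ {s} → Source D s → s ≡ center (star s)
  source-is-center {s} s-src with star-attached s
  ... | inj₁ s≡c = s≡c
  ... | inj₂ (ns , _) = ⊥-elim (ns s-src)

  star-nontrivial : ∀ i → ∃[ v ] (star v ≡ i × v ≢ center i)
  star-nontrivial i =
    let (y , ci→y) = od (center i)
        (u , nu , u→y) = nonSourcePredator (prey-nonSource ci→y)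
    in u , star-unique (inj₂ (nu , y , ci→y , u→y))
         , λ u≡ci → nu (subst (Source D) (sym u≡ci) (center-source i))

  commonPrey⇒sameStar : ∀ {s x} → Source D s → ¬ Source D x → CommonPrey s x → star s ≡ star x
  commonPrey⇒sameStar s-src nx cp =
    sym (star-unique (subst (λ c → Attached c _) (source-is-center s-src) (inj₂ (nx , cp))))

  center⇒commonPrey : ∀ {x y} → x ≢ y → x ≡ center (star y) → CommonPrey x y
  center⇒commonPrey {x} {y} x≢y x≡c with star-attached y
  ... | inj₁ y≡c = ⊥-elim (x≢y (trans x≡c (sym y≡c)))
  ... | inj₂ (_ , cp) = subst (λ c → CommonPrey c y) (sym x≡c) cp

  commonPrey-sym : ∀ {x y} → CommonPrey x y → CommonPrey y x
  commonPrey-sym (w , x→w , y→w) = w , y→w , x→w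

  StarEdge : Vertex D → Vertex D → Set
  StarEdge x y = star x ≡ star y × x ≢ y × (x ≡ center (star x) ⊎ y ≡ center (star y))

  commonPrey⇔starEdge : ∀ x y → (x ≢ y × CommonPrey x y) ⇔ StarEdge x y
  commonPrey⇔starEdge x y = mk⇔ starEdge commonPrey
    where
    starEdge : x ≢ y × CommonPrey x y → StarEdge x y
    starEdge (x≢y , cp) with commonPrey-source-nonSource x≢y cp
    ... | inj₁ (sx , ny) = commonPrey⇒sameStar sx ny cp , x≢y , inj₁ (source-is-center sx)
    ... | inj₂ (nx , sy) =
      sym (commonPrey⇒sameStar sy nx (commonPrey-sym cp)) , x≢y , inj₂ (source-is-center sy)

    commonPrey : StarEdge x y → x ≢ y × CommonPrey x y
    commonPrey (same , x≢y , inj₁ x≡c) =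
      x≢y , center⇒commonPrey x≢y (trans x≡c (cong center same))
    commonPrey (same , x≢y , inj₂ y≡c) =
      x≢y , commonPrey-sym (center⇒commonPrey (≢-sym x≢y) (trans y≡c (cong center (sym same))))

proposition3p3 : (D : Digraph) → OutdegPos D → StarGenerating D →
    (k : ℕ) → 1 ≤ k → HasKSources D k →
    (m : ℕ) → 1 ≤ m → DisjointUnionOfStars (CompEdge D m) k (Source D)
proposition3p3 D od sg k _ hk (suc m) _ =
  center , star , star-center , center-source , star-nontrivial , edges
  where
  open WalkProperties D
  open StarDecomposition D od sg hk

  edges : ∀ x y → CompEdge D (suc m) x y ⇔ StarEdge x y
  edges x y = ⇔.trans (compEdge⇔commonPrey od nonSourcePredator-unique m x y)
                      (commonPrey⇔starEdge x y)
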